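{- Let $T$ be a MUL-tree and let $(u,v)$ and $(w,x)$ be two edges of $T$ lying on a path $P_{u,x}=(u,v,\dots,w,x)$ of $T$ (i.e., the path from $u$ to $x$ whose first edge is $(u,v)$ and whose last edge is $(w,x)$). If $|M_u^{uv}|=|M_w^{wx}|$ then $M_u^{uv}=M_w^{wx}$; otherwise $M_u^{uv}\subset M_w^{wx}$.
   Context: A MUL-tree is a triple $(T,M,\psi)$, where $T$ is an unrooted tree with leaf set $\mathcal{L}(T)$ all of whose internal (non-leaf) nodes have degree at least three, $M$ is a finite set of labels, and $\psi:\mathcal{L}(T)\to M$ is a surjective map assigning a label to each leaf; we refer to it simply by $T$. For an edge $(u,v)$ of $T$, deleting $(u,v)$ leaves two subtrees: $T_u^{uv}$ (containing $u$) and $T_v^{uv}$ (containing $v$). $M_u^{uv}$ is the set of labels appearing on leaves of $T_u^{uv}$ but on no leaf of $T_v^{uv}$; $M_v^{uv}$ is defined symmetrically. -}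

module Defs where

open import Data.Nat using (ℕ; _≤_; _+_)
open import Data.Bool using (Bool; true; false; if_then_else_)
open import Data.Fin using (Fin)
open import Data.List using (List; []; _∷_; _++_; length; map; allFin)
open import Data.Nat.ListAction using (sum)
open import Data.List.Relation.Unary.Linked using (Linked)
open import Data.List.Relation.Unary.Unique.Propositional using (Unique)
open import Data.List.Membership.Propositional using (_∈_)
open import Data.Product using (Σ; ∃; ∃-syntax; _×_; _,_)
open import Data.Sum using (_⊎_)
open import Relation.Binary.PropositionalEquality using (_≡_; _≢_)
open import Relation.Nullary using (¬_)

record Graph (n : ℕ) : Set where
  field
    adj       : Fin n → Fin n → Bool
    adj-sym   : ∀ a b → adj a b ≡ adj b a
    adj-irrefl : ∀ a → adj a a ≡ false

module _ {n : ℕ} (G : Graph n) where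
  open Graph G

  Adj : Fin n → Fin n → Set
  Adj a b = adj a b ≡ true

  degree : Fin n → ℕ
  degree v = sum (map (λ w → if adj v w then 1 else 0) (allFin n))

  IsPath : List (Fin n) → Set
  IsPath ps = Linked Adj ps × Unique ps

  WalkIn : (Fin n → Fin n → Set) → Fin n → Fin n → Set
  WalkIn R a b = ∃[ ps ] (Linked R (a ∷ ps) × ∃[ qs ] (a ∷ ps ≡ qs ++ b ∷ []))

  Connected : Set
  Connected = ∀ a b → WalkIn Adj a b

  HasCycle : Set
  HasCycle = ∃[ ps ] (3 ≤ length ps × IsPath ps ×
               ∃[ a ] ∃[ rs ] ∃[ z ] (ps ≡ a ∷ rs ++ z ∷ [] × Adj z a))

  IsTree : Set
  IsTree = Connected × ¬ HasCycle

  IsLeaf : Fin n → Set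
  IsLeaf v = degree v ≤ 1

  AdjWithout : Fin n → Fin n → Fin n → Fin n → Set
  AdjWithout u v a b = Adj a b × ¬ (a ≡ u × b ≡ v) × ¬ (a ≡ v × b ≡ u)

  -- y is a vertex of the subtree T_u^{uv} (component of u after deleting uv)
  InSubtree : Fin n → Fin n → Fin n → Set
  InSubtree u v y = WalkIn (AdjWithout u v) u y

-- MUL-trees: T a tree whose internal nodes have degree ≥ 3, label set
-- M = Fin m, ψ assigning labels to leaves (its values on internal nodes are
-- irrelevant), surjective onto M via leaves.

record MULTree (n m : ℕ) : Set where
  field
    graph    : Graph n
    isTree   : IsTree graph
    internal : ∀ v → IsLeaf graph v ⊎ 3 ≤ degree graph v
    ψ        : Fin n → Fin m
    ψ-surj   : ∀ a → ∃[ y ] (IsLeaf graph y × ψ y ≡ a)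

module _ {n m : ℕ} (T : MULTree n m) where
  open MULTree T

  LabelOnSide : Fin n → Fin n → Fin m → Set
  LabelOnSide u v a = ∃[ y ] (IsLeaf graph y × InSubtree graph u v y × ψ y ≡ a)

  Mset : Fin n → Fin n → Fin m → Set
  Mset u v a = LabelOnSide u v a × ¬ LabelOnSide v u a

  PathThrough : Fin n → Fin n → Fin n → Fin n → Set
  PathThrough u v w x = ∃[ ps ] (IsPath graph ps ×
                          ∃[ qs ] (ps ≡ u ∷ v ∷ qs) ×
                          ∃[ rs ] (ps ≡ rs ++ w ∷ x ∷ []))

module _ {m : ℕ} where
  HasSize : (Fin m → Set) → ℕ → Set
  HasSize P k = ∃[ xs ] (Unique xs × length xs ≡ k ×
                  (∀ a → (P a → a ∈ xs) × (a ∈ xs → P a)))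

  _≐_ : (Fin m → Set) → (Fin m → Set) → Set
  A ≐ B = ∀ a → (A a → B a) × (B a → A a)

  _⊂_ : (Fin m → Set) → (Fin m → Set) → Set
  A ⊂ B = (∀ a → A a → B a) × ∃[ b ] (B b × ¬ A b)

-- In a tree every edge is a bridge. Let W be a walk from u avoiding the edge uv.
-- If W also avoids wx, prefixing it with the part w … u of the path (which misses x)
-- gives a walk from w avoiding wx; if W passes through x, continuing along the part
-- x … v of the path (which misses u) gives a walk from u to v avoiding uv, which is
-- impossible. Hence T_u^{uv} ⊆ T_w^{wx}, symmetrically T_x^{wx} ⊆ T_v^{uv}, and so
-- M_u^{uv} ⊆ M_w^{wx}. An inclusion of finite sets is an equality when the
-- cardinalities agree and strict otherwise.
module Submission where

open import Defs
open import Level using (0ℓ)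
open import Data.Nat using (ℕ; suc; _≤_; _<_; s≤s; z≤n)
open import Data.Nat.Properties using (≤-antisym; <-irrefl; +-suc)
open import Data.Fin using (Fin) renaming (_≟_ to _≟ᶠ_)
open import Data.List using (List; []; _∷_; _++_; length)
open import Data.List.Properties using (length-++; ++-assoc; ∷-injectiveˡ; ∷-injectiveʳ; ∷ʳ-injective)
open import Data.List.Relation.Unary.Linked using (Linked; []; [-]; _∷_)
import Data.List.Relation.Unary.Linked as Linked
open import Data.List.Relation.Unary.Unique.Propositional using (Unique)
open import Data.List.Relation.Unary.AllPairs using ([]; _∷_)
import Data.List.Relation.Unary.AllPairs as AllPairs
open import Data.List.Relation.Unary.All as All using (All; []; _∷_; all?)
open import Data.List.Relation.Unary.All.Properties using (¬Any⇒All¬; ¬All⇒Any¬; ++⁻ʳ)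
open import Data.List.Relation.Unary.Any using (here; there)
open import Data.List.Membership.Propositional using (_∈_; find)
open import Data.List.Membership.Propositional.Properties using (∈-++⁺ˡ; ∈-++⁺ʳ; ∈-++⁻; ∈-∃++)
import Data.List.Membership.DecPropositional as DecMembership
open import Data.List.Relation.Binary.Subset.Propositional using (_⊆_)
open import Data.Product using (Σ-syntax; ∃-syntax; _×_; _,_; proj₁; proj₂)
open import Data.Sum using (_⊎_; inj₁; inj₂)
open import Data.Empty using (⊥-elim)
open import Function using (_∘_)
open import Relation.Nullary using (¬_; Dec; yes; no)
open import Relation.Nullary.Decidable using (_×-dec_; map′; decidable-stable)
open import Relation.Binary.Core using (Rel; _⇒_)
open import Relation.Binary.Definitions using (DecidableEquality; Symmetric)
open import Relation.Binary.PropositionalEquality using (_≡_; _≢_; refl; sym; trans; cong; subst; ≢-sym)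
open import Relation.Binary.Construct.Closure.ReflexiveTransitive using (Star; ε; _◅_; _◅◅_)
import Relation.Binary.Construct.Closure.ReflexiveTransitive as Star

module _ {A : Set} {R : Rel A 0ℓ} where

  Linked-++⁻ˡ : ∀ xs {ys} → Linked R (xs ++ ys) → Linked R xs
  Linked-++⁻ˡ [] _ = []
  Linked-++⁻ˡ (_ ∷ []) _ = [-]
  Linked-++⁻ˡ (_ ∷ b ∷ xs) (r ∷ l) = r ∷ Linked-++⁻ˡ (b ∷ xs) l

  Linked-++⁻ʳ : ∀ xs {ys} → Linked R (xs ++ ys) → Linked R ys
  Linked-++⁻ʳ [] l = l
  Linked-++⁻ʳ (_ ∷ xs) l = Linked-++⁻ʳ xs (Linked.tail l)

module _ {A : Set} where

  Unique⇒All≢-prefix : ∀ xs {y : A} {ys} → Unique (xs ++ y ∷ ys) → All (y ≢_) xs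
  Unique⇒All≢-prefix [] _ = []
  Unique⇒All≢-prefix (_ ∷ xs) (a≢ ∷ xs!) = ≢-sym (All.head (++⁻ʳ xs a≢)) ∷ Unique⇒All≢-prefix xs xs!

  Unique⇒length≤ : ∀ {xs ys : List A} → Unique xs → xs ⊆ ys → length xs ≤ length ys
  Unique⇒length≤ {[]} _ _ = z≤n
  Unique⇒length≤ {x ∷ xs} (x∉xs ∷ xs!) xs⊆ys with pre , post , refl ← ∈-∃++ (xs⊆ys (here refl)) =
    subst (suc (length xs) ≤_) (sym length-removed) (s≤s (Unique⇒length≤ xs! xs⊆pre++post))
    where
    length-removed : length (pre ++ x ∷ post) ≡ suc (length (pre ++ post))
    length-removed = trans (length-++ pre) (trans (+-suc (length pre) (length post)) (cong suc (sym (length-++ pre))))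

    xs⊆pre++post : xs ⊆ pre ++ post
    xs⊆pre++post a∈xs with ∈-++⁻ pre (xs⊆ys (there a∈xs))
    ... | inj₁ a∈pre = ∈-++⁺ˡ a∈pre
    ... | inj₂ (here refl) = ⊥-elim (All.lookup x∉xs a∈xs refl)
    ... | inj₂ (there a∈post) = ∈-++⁺ʳ pre a∈post

module _ {A : Set} {R : Rel A 0ℓ} where

  visits : ∀ {a b} → Star R a b → List A
  visits ε = []
  visits (_◅_ {j = b} _ w) = b ∷ visits w

  vertices : ∀ {a b} → Star R a b → List A
  vertices {a} w = a ∷ visits w

  vertices-Linked : ∀ {a b} (w : Star R a b) → Linked R (vertices w)
  vertices-Linked ε = [-]
  vertices-Linked (r ◅ w) = r ∷ vertices-Linked w

  vertices-last : ∀ {a b} (w : Star R a b) → ∃[ qs ] (vertices w ≡ qs ++ b ∷ [])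
  vertices-last ε = [] , refl
  vertices-last {a} (r ◅ w) with qs , eq ← vertices-last w = a ∷ qs , cong (a ∷_) eq

Path : {A : Set} → Rel A 0ℓ → Rel A 0ℓ
Path R a b = Σ[ w ∈ Star R a b ] Unique (vertices w)

module _ {A : Set} (_≟_ : DecidableEquality A) {R : Rel A 0ℓ} where
  open DecMembership _≟_ using (_∈?_)

  dropUntil : ∀ {a b c} (w : Star R b c) → a ∈ vertices w → Unique (vertices w) → Path R a c
  dropUntil w (here refl) w! = w , w!
  dropUntil (_ ◅ w) (there a∈w) (_ ∷ w!) = dropUntil w a∈w w!

  -- If the source of the new edge already lies on the path, the loop through it is cut off.
  _◅ₚ_ : ∀ {a b c} → R a b → Path R b c → Path R a c
  _◅ₚ_ {a} r (w , w!) with a ∈? vertices w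
  ... | yes a∈w = dropUntil w a∈w w!
  ... | no a∉w = r ◅ w , ¬Any⇒All¬ _ a∉w ∷ w!

  Star⇒Path : ∀ {a b} → Star R a b → Path R a b
  Star⇒Path = Star.fold (Path R) _◅ₚ_ (ε , [] ∷ [])

-- Deleting the undirected edge pq; AdjWithout G p q is Without (Adj G) p q by definition.
Without : {A : Set} → Rel A 0ℓ → A → A → Rel A 0ℓ
Without R p q s t = R s t × ¬ (s ≡ p × t ≡ q) × ¬ (s ≡ q × t ≡ p)

Avoiding : {A : Set} → Rel A 0ℓ → A → Rel A 0ℓ
Avoiding R c s t = R s t × c ≢ s × c ≢ t

module _ {A : Set} {R : Rel A 0ℓ} where

  Without-mono : ∀ {S : Rel A 0ℓ} {p q} → R ⇒ S → Without R p q ⇒ Without S p q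
  Without-mono f (r , ¬pq , ¬qp) = f r , ¬pq , ¬qp

  Avoiding⇒Withoutˡ : ∀ {c d} → Avoiding R c ⇒ Without R c d
  Avoiding⇒Withoutˡ (r , c≢s , c≢t) = r , (λ (s≡c , _) → c≢s (sym s≡c)) , (λ (_ , t≡c) → c≢t (sym t≡c))

  Avoiding⇒Withoutʳ : ∀ {c d} → Avoiding R c ⇒ Without R d c
  Avoiding⇒Withoutʳ (r , c≢s , c≢t) = r , (λ (_ , t≡c) → c≢t (sym t≡c)) , (λ (s≡c , _) → c≢s (sym s≡c))

  Avoiding-sym : ∀ {c} → Symmetric R → Symmetric (Avoiding R c)
  Avoiding-sym R-sym (r , c≢s , c≢t) = R-sym r , c≢t , c≢s

  avoids⊎reaches : DecidableEquality A → ∀ p q {a y} → Star R a y →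
                   Star (Without R p q) a y ⊎ (Star R a p × Star R a q)
  avoids⊎reaches _≟_ p q ε = inj₁ ε
  avoids⊎reaches _≟_ p q (_◅_ {i = a} {j = b} r w) with (a ≟ p) ×-dec (b ≟ q) | (a ≟ q) ×-dec (b ≟ p)
  ... | yes (refl , refl) | _ = inj₂ (ε , r ◅ ε)
  ... | no _ | yes (refl , refl) = inj₂ (r ◅ ε , ε)
  ... | no ¬pq | no ¬qp with avoids⊎reaches _≟_ p q w
  ...   | inj₁ w′ = inj₁ ((r , ¬pq , ¬qp) ◅ w′)
  ...   | inj₂ (wp , wq) = inj₂ (r ◅ wp , r ◅ wq)

  Linked⇒Star-fromHead : ∀ {c a q xs} → Linked R (a ∷ xs) → All (c ≢_) (a ∷ xs) →
                         q ∈ a ∷ xs → Star (Avoiding R c) a q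
  Linked⇒Star-fromHead _ _ (here refl) = ε
  Linked⇒Star-fromHead (r ∷ l) (c≢a ∷ c≢xs@(c≢b ∷ _)) (there q∈) =
    (r , c≢a , c≢b) ◅ Linked⇒Star-fromHead l c≢xs q∈

  Linked⇒Star : Symmetric R → ∀ {c p q xs} → Linked R xs → All (c ≢_) xs →
                p ∈ xs → q ∈ xs → Star (Avoiding R c) p q
  Linked⇒Star R-sym {xs = _ ∷ _} l c≢xs p∈ q∈ =
    Star.reverse (Avoiding-sym R-sym) (Linked⇒Star-fromHead l c≢xs p∈) ◅◅ Linked⇒Star-fromHead l c≢xs q∈

module _ {n : ℕ} (G : Graph n) where
  open Graph G

  Adj-sym : Symmetric (Adj G)
  Adj-sym {a} {b} ab = trans (adj-sym b a) ab

  WalkIn⇒Star : ∀ {R a b} → WalkIn G R a b → Star R a b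
  WalkIn⇒Star {R} (ps , l , qs , eq) = walk⇒Star ps l qs eq
    where
    walk⇒Star : ∀ {a b} ps → Linked R (a ∷ ps) → ∀ qs → a ∷ ps ≡ qs ++ b ∷ [] → Star R a b
    walk⇒Star [] _ qs eq with refl ← proj₂ (∷ʳ-injective [] qs eq) = ε
    walk⇒Star (_ ∷ _) _ [] ()
    walk⇒Star (_ ∷ ps) (r ∷ l) (_ ∷ qs) eq = r ◅ walk⇒Star ps l qs (∷-injectiveʳ eq)

  Star⇒WalkIn : ∀ {R a b} → Star R a b → WalkIn G R a b
  Star⇒WalkIn w = visits w , vertices-Linked w , vertices-last w

  -- A simple walk a → b of length ≥ 2 avoiding the edge ab closes a cycle with it.
  ¬HasCycle⇒bridge : ¬ HasCycle G → ∀ {a b} → Adj G a b → ¬ Star (AdjWithout G a b) a b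
  ¬HasCycle⇒bridge acyclic {a} {b} ab w with Star⇒Path _≟ᶠ_ w
  ... | ε , _ with () ← trans (sym (adj-irrefl a)) ab
  ... | r ◅ ε , _ = proj₁ (proj₂ r) (refl , refl)
  ... | r ◅ w′@(_ ◅ _) , w! with qs , last ← vertices-last w′ =
    acyclic (a ∷ vertices w′ , s≤s (s≤s (s≤s z≤n)) ,
             (Linked.map proj₁ (vertices-Linked (r ◅ w′)) , w!) ,
             a , qs , b , cong (a ∷_) last , Adj-sym ab)

  InSubtree-mono : ¬ HasCycle G → ∀ {u v w x} → Adj G u v →
                   Star (Avoiding (Adj G) x) w u → Star (Avoiding (Adj G) u) x v →
                   ∀ {y} → InSubtree G u v y → InSubtree G w x y
  InSubtree-mono acyclic {u} {v} {w} {x} uv wu xv uy with avoids⊎reaches _≟ᶠ_ w x (WalkIn⇒Star uy)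
  ... | inj₁ uy′ = Star⇒WalkIn (Star.map (Avoiding⇒Withoutʳ {R = Adj G}) wu ◅◅
                                Star.map (Without-mono {R = AdjWithout G u v} proj₁) uy′)
  ... | inj₂ (_ , ux) = ⊥-elim (¬HasCycle⇒bridge acyclic uv (ux ◅◅ Star.map (Avoiding⇒Withoutˡ {R = Adj G}) xv))

module _ {n m : ℕ} (T : MULTree n m) where
  open MULTree T

  PathThrough⇒walks : ∀ {u v w x} → PathThrough T u v w x →
    Adj graph u v × Adj graph w x ×
    Star (Avoiding (Adj graph) x) w u × Star (Avoiding (Adj graph) u) x v
  PathThrough⇒walks {u} {v} {w} {x} (_ , (ps-linked , ps!) , qs , refl , rs , ps≡) =
      Linked.head ps-linked
    , Linked.head (Linked-++⁻ʳ rs (subst (Linked (Adj graph)) ps≡ ps-linked))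
    , Linked⇒Star (Adj-sym graph) (Linked-++⁻ˡ (rs ++ w ∷ []) (subst (Linked (Adj graph)) ps≡′ ps-linked))
        (Unique⇒All≢-prefix (rs ++ w ∷ []) (subst Unique ps≡′ ps!)) (∈-++⁺ʳ rs (here refl)) (u∈ rs ps≡)
    , Linked⇒Star (Adj-sym graph) (Linked.tail ps-linked) (AllPairs.head ps!) (x∈ rs ps≡) (here refl)
    where
    ps≡′ : u ∷ v ∷ qs ≡ (rs ++ w ∷ []) ++ x ∷ []
    ps≡′ = trans ps≡ (sym (++-assoc rs (w ∷ []) (x ∷ [])))

    u∈ : ∀ rs → u ∷ v ∷ qs ≡ rs ++ w ∷ x ∷ [] → u ∈ rs ++ w ∷ []
    u∈ [] eq = here (∷-injectiveˡ eq)
    u∈ (_ ∷ _) eq = here (∷-injectiveˡ eq)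

    x∈ : ∀ rs → u ∷ v ∷ qs ≡ rs ++ w ∷ x ∷ [] → x ∈ v ∷ qs
    x∈ [] eq = here (sym (∷-injectiveˡ (∷-injectiveʳ eq)))
    x∈ (_ ∷ rs) eq = subst (x ∈_) (sym (∷-injectiveʳ eq)) (∈-++⁺ʳ rs (there (here refl)))

  Mset-mono : ∀ {u v w x} → PathThrough T u v w x → ∀ a → Mset T u v a → Mset T w x a
  Mset-mono path a ((y , leaf , uy , ψy) , ¬vu) with uv , wx , wu , xv ← PathThrough⇒walks path =
      (y , leaf , InSubtree-mono graph (proj₂ isTree) uv wu xv uy , ψy)
    , λ (y′ , leaf′ , xy′ , ψy′) →
        ¬vu (y′ , leaf′ , InSubtree-mono graph (proj₂ isTree) (Adj-sym graph wx) (reverse xv) (reverse wu) xy′ , ψy′)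
    where
    reverse : ∀ {c p q} → Star (Avoiding (Adj graph) c) p q → Star (Avoiding (Adj graph) c) q p
    reverse = Star.reverse (Avoiding-sym (Adj-sym graph))

module _ {m : ℕ} where
  open DecMembership (_≟ᶠ_ {m}) using (_∈?_)

  private variable
    P Q : Fin m → Set
    k l : ℕ

  HasSize⇒Dec : HasSize P k → ∀ a → Dec (P a)
  HasSize⇒Dec (xs , _ , _ , P⇔) a = map′ (proj₂ (P⇔ a)) (proj₁ (P⇔ a)) (a ∈? xs)

  HasSize-⊆⇒≤ : (∀ a → P a → Q a) → HasSize P k → HasSize Q l → k ≤ l
  HasSize-⊆⇒≤ P⊆Q (xs , xs! , refl , P⇔) (ys , _ , refl , Q⇔) =
    Unique⇒length≤ xs! λ {a} a∈xs → proj₁ (Q⇔ a) (P⊆Q a (proj₂ (P⇔ a) a∈xs))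

  HasSize-⊂⇒< : ∀ {b} → (∀ a → P a → Q a) → Q b → ¬ P b → HasSize P k → HasSize Q l → k < l
  HasSize-⊂⇒< {b = b} P⊆Q Qb ¬Pb (xs , xs! , refl , P⇔) (ys , _ , refl , Q⇔) =
    Unique⇒length≤ (¬Any⇒All¬ xs (¬Pb ∘ proj₂ (P⇔ b)) ∷ xs!) λ where
      (here refl) → proj₁ (Q⇔ b) Qb
      (there a∈xs) → proj₁ (Q⇔ _) (P⊆Q _ (proj₂ (P⇔ _) a∈xs))

  HasSize⇒⊆⊎∃∖ : HasSize Q l → (∀ a → Dec (P a)) → (∀ a → Q a → P a) ⊎ ∃[ b ] (Q b × ¬ P b)
  HasSize⇒⊆⊎∃∖ (ys , _ , _ , Q⇔) P? with all? P? ys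
  ... | yes P-ys = inj₁ λ a Qa → All.lookup P-ys (proj₁ (Q⇔ a) Qa)
  ... | no ¬P-ys with b , b∈ys , ¬Pb ← find (¬All⇒Any¬ P? ys ¬P-ys) = inj₂ (b , proj₂ (Q⇔ b) b∈ys , ¬Pb)

  HasSize-⊆⇒≐⊎⊂ : (∀ a → P a → Q a) → HasSize P k → HasSize Q l →
                  (k ≡ l → P ≐ Q) × (k ≢ l → P ⊂ Q)
  HasSize-⊆⇒≐⊎⊂ {P = P} {Q = Q} P⊆Q sP sQ = equal , strict
    where
    equal : _ ≡ _ → P ≐ Q
    equal refl a = P⊆Q a , λ Qa →
      decidable-stable (HasSize⇒Dec sP a) λ ¬Pa → <-irrefl refl (HasSize-⊂⇒< P⊆Q Qa ¬Pa sP sQ)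

    strict : _ ≢ _ → P ⊂ Q
    strict k≢l with HasSize⇒⊆⊎∃∖ sQ (HasSize⇒Dec sP)
    ... | inj₁ Q⊆P = ⊥-elim (k≢l (≤-antisym (HasSize-⊆⇒≤ P⊆Q sP sQ) (HasSize-⊆⇒≤ Q⊆P sQ sP)))
    ... | inj₂ witness = P⊆Q , witness

lemma1 : ∀ {n m} (T : MULTree n m) (u v w x : Fin n) →
    PathThrough T u v w x →
    ∀ (k l : ℕ) → HasSize (Mset T u v) k → HasSize (Mset T w x) l →
    (k ≡ l → Mset T u v ≐ Mset T w x) × (k ≢ l → Mset T u v ⊂ Mset T w x)
lemma1 T u v w x path k l = HasSize-⊆⇒≐⊎⊂ (Mset-mono T path)
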